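{- For every $\varepsilon > 0$ and every $x > 0$ there exist $n \in \mathbb{N}$ and growth rates $h_1,\dots,h_n>0$ with $\sum_i h_i = 1$ such that, in the bamboo trimming process run with Reduce-Fastest$(x)$ (with any tie-breaking), some bamboo reaches height at least $x + 1 - \varepsilon$.
   Context: Bamboo trimming problem: bamboo $b_1,\dots,b_n$ with growth rates $h_i>0$, all starting at height $0$; each time step consists of every $b_i$ growing by $h_i$, after which the algorithm cuts at most one bamboo to height $0$. Reduce-Fastest$(x)$: after the growth phase of each step, among bamboo with height at least $x$, cut one with the largest growth rate (ties broken arbitrarily); if none has height at least $x$, cut nothing. Heights are considered at all times, including after growth and before the cut.
   Formalization: The parameters ε and x range over the positive rationals, and the growth rates are taken in ℚ. -}

module Defs where

open import Data.Nat using (ℕ; zero; suc)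
open import Data.Fin using (Fin; _≟_)
open import Data.Maybe using (Maybe; just; nothing)
open import Data.Rational using (ℚ; 0ℚ; _+_; _≤_; _<_)
open import Relation.Nullary using (yes; no)

∑ : ∀ {n} → (Fin n → ℚ) → ℚ
∑ {zero}  f = 0ℚ
∑ {suc n} f = f Fin.zero + ∑ (λ i → f (Fin.suc i))

Schedule : ℕ → Set
Schedule n = ℕ → Maybe (Fin n)

afterCut : ∀ {n} → Maybe (Fin n) → Fin n → ℚ → ℚ
afterCut nothing  i q = q
afterCut (just j) i q with j ≟ i
... | yes _ = 0ℚ
... | no  _ = q

mutual
  before : ∀ {n} → (Fin n → ℚ) → Schedule n → ℕ → Fin n → ℚ
  before h c zero    i = 0ℚ
  before h c (suc k) i = afterCut (c k) i (grown h c k i)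

  -- height of bamboo i at step k after the growth phase, before the cut
  grown : ∀ {n} → (Fin n → ℚ) → Schedule n → ℕ → Fin n → ℚ
  grown h c k i = before h c k i + h i

data ValidStep {n} (x : ℚ) (h : Fin n → ℚ) (c : Schedule n) (k : ℕ) : Maybe (Fin n) → Set where
  cutOne  : (i : Fin n) → x ≤ grown h c k i →
            (∀ j → x ≤ grown h c k j → h j ≤ h i) → ValidStep x h c k (just i)
  cutNone : (∀ j → grown h c k j < x) → ValidStep x h c k nothing

ReduceFastest : ∀ {n} → ℚ → (Fin n → ℚ) → Schedule n → Set
ReduceFastest x h c = ∀ k → ValidStep x h c k (c k)

{-# OPTIONS --safe #-}
-- Take m + 1 bamboo of rate 1/(m+1) ≤ ε. Until the first step k₀ at which the common height
-- (k₀+1)/(m+1) reaches x nothing is cut, so all heights agree. The m steps k₀, …, k₀+m-1 cut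
-- at most m bamboo, so some bamboo is uncut before step k₀+m, where it grows to
-- (k₀+1+m)/(m+1) ≥ x + 1 - 1/(m+1) ≥ x + 1 - ε.
module Submission where

open import Defs
open import Data.Nat as ℕ using (ℕ; zero; suc; s≤s; z≤n)
import Data.Nat.Properties as ℕP
open import Data.Nat.Coprimality using (1-coprimeTo)
open import Data.Nat.Tactic.RingSolver using (solve)
import Data.Integer as ℤ
import Data.Integer.Properties as ℤP
open import Data.Fin using (Fin; toℕ; fromℕ<; _≟_)
open import Data.Fin.Properties using (toℕ-fromℕ<; pigeonhole; <⇒≢; any?; ¬∀⟶∃¬)
open import Data.Maybe using (Maybe; just; nothing)
open import Data.Maybe.Properties using (just-injective; ≡-dec)
open import Data.Product using (Σ; ∃; _×_; _,_; proj₁; proj₂)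
open import Data.Sum using (inj₁; inj₂)
open import Data.List using ([]; _∷_)
open import Data.Rational
  using (ℚ; 0ℚ; 1ℚ; _+_; _-_; -_; _≤_; _<_; mkℚ; toℚᵘ; *≤*; *<*; +-0-rawMonoid)
import Data.Rational.Properties as ℚP
open import Data.Rational.Unnormalised as ℚᵘ using (mkℚᵘ) renaming (_≃_ to _≃ᵘ_; _≤_ to _≤ᵘ_)
import Data.Rational.Unnormalised.Properties as ℚᵘP
open import Algebra.Definitions.RawMonoid +-0-rawMonoid using () renaming (_×_ to _·_)
open import Algebra.Properties.Monoid.Mult ℚP.+-0-monoid using (×-homo-+)
open import Algebra.Properties.AbelianGroup ℚP.+-0-abelianGroup using (xyx⁻¹≈y)
open import Relation.Nullary using (¬_; Dec; yes; no; contradiction)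
open import Relation.Binary.PropositionalEquality using (_≡_; _≢_; refl; sym; trans; cong; subst)

1/[1+_] : ℕ → ℚ
1/[1+ m ] = mkℚ (ℤ.+ 1) m (1-coprimeTo (suc m))

1/[1+]-pos : ∀ m → 0ℚ < 1/[1+ m ]
1/[1+]-pos m = *<* (ℤ.+<+ (s≤s z≤n))

toℚᵘ-·-1/[1+] : ∀ m k → toℚᵘ (k · 1/[1+ m ]) ≃ᵘ mkℚᵘ (ℤ.+ k) m
toℚᵘ-·-1/[1+] m zero    = ℚᵘ.*≡* refl
toℚᵘ-·-1/[1+] m (suc k) = begin-equality
  toℚᵘ (1/[1+ m ] + k · 1/[1+ m ])         ≃⟨ ℚP.toℚᵘ-homo-+ 1/[1+ m ] (k · 1/[1+ m ]) ⟩
  mkℚᵘ (ℤ.+ 1) m ℚᵘ.+ toℚᵘ (k · 1/[1+ m ]) ≃⟨ ℚᵘP.+-congʳ (mkℚᵘ (ℤ.+ 1) m) (toℚᵘ-·-1/[1+] m k) ⟩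
  mkℚᵘ (ℤ.+ 1) m ℚᵘ.+ mkℚᵘ (ℤ.+ k) m       ≃⟨ 1/[1+m]+k/[1+m] k ⟩
  mkℚᵘ (ℤ.+ suc k) m                       ∎
  where
  open ℚᵘP.≤-Reasoning
  -- The case split lets the signs of the integer products compute, leaving ℕ identities.
  1/[1+m]+k/[1+m] : ∀ k → mkℚᵘ (ℤ.+ 1) m ℚᵘ.+ mkℚᵘ (ℤ.+ k) m ≃ᵘ mkℚᵘ (ℤ.+ suc k) m
  1/[1+m]+k/[1+m] zero    = ℚᵘ.*≡* (cong ℤ.+_ (solve (m ∷ [])))
  1/[1+m]+k/[1+m] (suc k) = ℚᵘ.*≡* (cong ℤ.+_ (solve (k ∷ m ∷ [])))

≤-·-1/[1+] : ∀ {x} m k → toℚᵘ x ≤ᵘ mkℚᵘ (ℤ.+ k) m → x ≤ k · 1/[1+ m ]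
≤-·-1/[1+] m k x≤k/[1+m] =
  ℚP.toℚᵘ-cancel-≤ (ℚᵘP.≤-respʳ-≃ (ℚᵘP.≃-sym (toℚᵘ-·-1/[1+] m k)) x≤k/[1+m])

[1+m]·1/[1+m]≡1 : ∀ m → suc m · 1/[1+ m ] ≡ 1ℚ
[1+m]·1/[1+m]≡1 m = ℚP.toℚᵘ-injective
  (ℚᵘP.≃-trans (toℚᵘ-·-1/[1+] m (suc m)) (ℚᵘ.*≡* (ℤP.*-comm (ℤ.+ suc m) (ℤ.+ 1))))

m·1/[1+m]≡1-1/[1+m] : ∀ m → m · 1/[1+ m ] ≡ 1ℚ - 1/[1+ m ]
m·1/[1+m]≡1-1/[1+m] m =
  trans (sym (xyx⁻¹≈y 1/[1+ m ] (m · 1/[1+ m ]))) (cong (_- 1/[1+ m ]) ([1+m]·1/[1+m]≡1 m))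

∃1/[1+m]≤ : ∀ {ε} → 0ℚ < ε → ∃ λ m → 1/[1+ m ] ≤ ε
∃1/[1+m]≤ {mkℚ ℤ.+0 _ _}       (*<* (ℤ.+<+ ()))
∃1/[1+m]≤ {mkℚ ℤ.-[1+ _ ] _ _} (*<* ())
∃1/[1+m]≤ {mkℚ ℤ.+[1+ a ] d _} _ = d , *≤* (ℤ.+≤+ (ℕP.*-monoˡ-≤ (suc d) (s≤s (z≤n {a}))))

archimedean : ∀ m x → ∃ λ k → x ≤ suc k · 1/[1+ m ]
archimedean m (mkℚ ℤ.+0 d _)       = 0 , ≤-·-1/[1+] m 1 (ℚᵘ.*≤* (ℤ.+≤+ z≤n))
archimedean m (mkℚ ℤ.-[1+ a ] d _) = 0 , ≤-·-1/[1+] m 1 (ℚᵘ.*≤* ℤ.-≤+)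
archimedean m (mkℚ ℤ.+[1+ a ] d _) =
  m ℕ.+ a ℕ.* suc m ,
  ≤-·-1/[1+] m (suc a ℕ.* suc m) (ℚᵘ.*≤* (ℤ.+≤+ (ℕP.m≤m*n (suc a ℕ.* suc m) (suc d))))

∑-const : ∀ n r → ∑ {n} (λ _ → r) ≡ n · r
∑-const zero    r = refl
∑-const (suc n) r = cong (r +_) (∑-const n r)

least : {P : ℕ → Set} → (∀ n → Dec (P n)) → ∃ P → ∃ λ k → P k × (∀ {j} → j ℕ.< k → ¬ P j)
least P? p with P? 0
least P? p             | yes p₀ = 0 , p₀ , λ ()
least P? (zero  , p)   | no ¬p₀ = contradiction p ¬p₀
least P? (suc n , p)   | no ¬p₀ with k , pk , below ← least (λ n → P? (suc n)) (n , p) =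
  suc k , pk , λ { {zero} _ → ¬p₀ ; {suc j} (s≤s j<k) → below j<k }

∃-missed : ∀ {m n} → m ℕ.< n → (f : Fin m → Maybe (Fin n)) → ∃ λ i → ∀ j → f j ≢ just i
∃-missed {m} {n} m<n f with ¬∀⟶∃¬ n Hit (λ i → any? λ j → ≡-dec _≟_ (f j) (just i)) notAllHit
  where
  Hit : Fin n → Set
  Hit i = ∃ λ j → f j ≡ just i
  notAllHit : ¬ (∀ i → Hit i)
  notAllHit hit with a , b , a<b , same ← pigeonhole m<n (λ i → proj₁ (hit i)) =
    <⇒≢ a<b (just-injective (trans (sym (proj₂ (hit a))) (trans (cong f same) (proj₂ (hit b)))))
... | i , ¬hit = i , λ j fj≡i → ¬hit (j , fj≡i)

UncutBefore : ∀ {n} → Schedule n → ℕ → Fin n → Set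
UncutBefore c k i = ∀ j → j ℕ.< k → c j ≢ just i

∃-uncut-window : ∀ {m n} (c : Schedule n) → m ℕ.< n → ∀ s →
                 ∃ λ i → ∀ t → t ℕ.< m → c (s ℕ.+ t) ≢ just i
∃-uncut-window c m<n s with i , missed ← ∃-missed m<n (λ t → c (s ℕ.+ toℕ t)) =
  i , λ t t<m → subst (λ t → c (s ℕ.+ t) ≢ just i) (toℕ-fromℕ< t<m) (missed (fromℕ< t<m))

afterCut-≢ : ∀ {n} (d : Maybe (Fin n)) i q → d ≢ just i → afterCut d i q ≡ q
afterCut-≢ nothing  i q _ = refl
afterCut-≢ (just j) i q d≢i with j ≟ i
... | yes refl = contradiction refl d≢i
... | no  _    = refl

module _ {n} (h : Fin n → ℚ) (c : Schedule n) where

  before-uncut : ∀ k i → UncutBefore c k i → before h c k i ≡ k · h i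
  grown-uncut  : ∀ k i → UncutBefore c k i → grown h c k i ≡ suc k · h i

  before-uncut zero    i _     = refl
  before-uncut (suc k) i uncut =
    trans (afterCut-≢ (c k) i _ (uncut k (ℕP.n<1+n k)))
          (grown-uncut k i (λ j j<k → uncut j (ℕP.m<n⇒m<1+n j<k)))

  grown-uncut k i uncut =
    trans (cong (_+ h i) (before-uncut k i uncut)) (ℚP.+-comm (k · h i) (h i))

module _ {n} {x : ℚ} {h : Fin n → ℚ} {c : Schedule n} (rf : ReduceFastest x h c) where

  cut⇒x≤grown : ∀ {k i} → c k ≡ just i → x ≤ grown h c k i
  cut⇒x≤grown {k} {i} ck≡i with subst (ValidStep x h c k) ck≡i (rf k)
  ... | cutOne .i x≤grown _ = x≤grown

  uncut-before-threshold : ∀ {k₀} → (∀ {k} i → k ℕ.< k₀ → ¬ x ≤ suc k · h i) →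
                           ∀ k → k ℕ.≤ k₀ → ∀ i → UncutBefore c k i
  uncut-before-threshold short zero    _    i j ()
  uncut-before-threshold short (suc k) k<k₀ i j j<1+k with ℕP.m<1+n⇒m<n∨m≡n j<1+k
  ... | inj₁ j<k  = uncut-before-threshold short k (ℕP.<⇒≤ k<k₀) i j j<k
  ... | inj₂ refl = λ cj≡i → short i k<k₀
    (subst (x ≤_) (grown-uncut h c j i (uncut-before-threshold short j (ℕP.<⇒≤ k<k₀) i))
                  (cut⇒x≤grown cj≡i))

∃-tall-bamboo : ∀ {m x r k₀} {c : Schedule (suc m)} → ReduceFastest x (λ _ → r) c →
                x ≤ suc k₀ · r → (∀ {k} → k ℕ.< k₀ → ¬ x ≤ suc k · r) →
                ∃ λ i → x + m · r ≤ grown (λ _ → r) c (k₀ ℕ.+ m) i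
∃-tall-bamboo {m} {x} {r} {k₀} {c} rf x≤ short
  with i , inWindow ← ∃-uncut-window c (ℕP.n<1+n m) k₀ = i , (begin
    x + m · r                      ≤⟨ ℚP.+-monoˡ-≤ (m · r) x≤ ⟩
    suc k₀ · r + m · r             ≡⟨ ×-homo-+ r (suc k₀) m ⟨
    suc (k₀ ℕ.+ m) · r             ≡⟨ grown-uncut _ c (k₀ ℕ.+ m) i uncut ⟨
    grown (λ _ → r) c (k₀ ℕ.+ m) i ∎)
  where
  open ℚP.≤-Reasoning
  uncut : UncutBefore c (k₀ ℕ.+ m) i
  uncut k k<k₀+m with k ℕP.<? k₀
  ... | yes k<k₀ = uncut-before-threshold rf (λ _ → short) k₀ ℕP.≤-refl i k k<k₀
  ... | no  k≮k₀ with t , refl ← ℕP.m≤n⇒∃[o]m+o≡n (ℕP.≮⇒≥ k≮k₀) =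
    inWindow t (ℕP.+-cancelˡ-< k₀ t m k<k₀+m)

theorem3p2 : (ε x : ℚ) → 0ℚ < ε → 0ℚ < x →
    Σ ℕ λ n → Σ (Fin n → ℚ) λ h →
    (∀ i → 0ℚ < h i) × ∑ h ≡ 1ℚ ×
    ((c : Schedule n) → ReduceFastest x h c →
    Σ ℕ λ k → Σ (Fin n) λ i → x + 1ℚ - ε ≤ grown h c k i)
theorem3p2 ε x 0<ε _ with m , u≤ε ← ∃1/[1+m]≤ 0<ε =
  suc m , (λ _ → u) , (λ _ → 1/[1+]-pos m) , trans (∑-const (suc m) u) ([1+m]·1/[1+m]≡1 m) , reach
  where
  u : ℚ
  u = 1/[1+ m ]
  reach : (c : Schedule (suc m)) → ReduceFastest x (λ _ → u) c →
          ∃ λ k → ∃ λ i → x + 1ℚ - ε ≤ grown (λ _ → u) c k i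
  reach c rf with k₀ , x≤ , below ← least (λ k → x ℚP.≤? suc k · u) (archimedean m x)
             with i , tall ← ∃-tall-bamboo rf x≤ below =
    k₀ ℕ.+ m , i , (begin
      x + 1ℚ - ε                     ≡⟨ ℚP.+-assoc x 1ℚ (- ε) ⟩
      x + (1ℚ - ε)                   ≤⟨ ℚP.+-monoʳ-≤ x (ℚP.+-monoʳ-≤ 1ℚ (ℚP.neg-antimono-≤ u≤ε)) ⟩
      x + (1ℚ - u)                   ≡⟨ cong (x +_) (m·1/[1+m]≡1-1/[1+m] m) ⟨
      x + m · u                      ≤⟨ tall ⟩
      grown (λ _ → u) c (k₀ ℕ.+ m) i ∎)
    where open ℚP.≤-Reasoning
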